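{- Let $m\ge1$, $S_1,\dots,S_k\subseteq\mathbb{Z}_m$, suppose $\Gamma=\mathrm{DiCay}(\mathbb{Z}_m,S_1,\dots,S_k)$ is reduced, and let $l$ be coprime to $m$. Then, as maps of $\mathrm{Aut}^{\mathrm{Ch}}(\Gamma)$, $\iota(\psi_l)\circ\gamma\circ\iota(\psi_l)^{ -1}=\gamma^l$.
   Context: $\mathrm{DiCay}(\mathbb{Z}_m,S_1,\dots,S_k)$ is the colored digraph on $\mathbb{Z}_m$ with color-$i$ edges $\{(x,y)\mid y-x\in S_i\}$; it is reduced iff no nonzero $h\in\mathbb{Z}_m$ satisfies $S_i+h=S_i$ for all $i$. The chain $\mathrm{Ch}(\Gamma)$ is the colored digraph on $\mathbb{Z}_m\times\mathbb{Z}$ with a color-$j$ edge from $(v,i)$ to $(w,i+1)$ iff $w-v\in S_j$. $\mathrm{Aut}_{\mathrm{Ch}}(\Gamma)$ is the group of sequences $(\sigma_i)_{i\in\mathbb{Z}}$ of permutations of $\mathbb{Z}_m$ with $(v,i)\mapsto(\sigma_i(v),i)$ a color-preserving automorphism of $\mathrm{Ch}(\Gamma)$; $\mathrm{Aut}^{\mathrm{Ch}}(\Gamma)=\{\sigma_0\}$. For reduced $\Gamma$, a sequence in $\mathrm{Aut}_{\mathrm{Ch}}(\Gamma)$ is determined by $\sigma_0$, and $\gamma:\mathrm{Aut}^{\mathrm{Ch}}(\Gamma)\to\mathrm{Aut}^{\mathrm{Ch}}(\Gamma)$ is defined by $\gamma(\sigma_0)=\sigma_1$. Also $\psi_l(x)=lx$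 and $\iota(\psi_l)(\varphi)=\psi_l\circ\varphi\circ\psi_l^{ -1}$, which maps $\mathrm{Aut}^{\mathrm{Ch}}(\Gamma)$ onto itself. -}

module Defs where

open import Data.Nat using (ℕ; zero; suc; _+_; _*_; _∸_; NonZero)
open import Data.Nat.DivMod using (_%_; m%n<n)
open import Data.Fin using (Fin; toℕ; fromℕ<)
open import Data.Fin.Subset using (Subset; _∈_)
open import Data.Fin.Permutation using (Permutation′; _⟨$⟩ʳ_)
open import Data.Integer using (ℤ; +_) renaming (_+_ to _+ℤ_)
open import Data.Product using (Σ; ∃; _×_)
open import Function using (_∘_)
open import Function.Bundles using (_⇔_)
open import Relation.Binary.PropositionalEquality using (_≡_; _≢_; _≗_)
open import Relation.Nullary using (¬_)

-- ℤ_m is represented by Fin m (m ≥ 1 via NonZero); arithmetic is mod m.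
reduceₘ : (m : ℕ) .{{_ : NonZero m}} → ℕ → Fin m
reduceₘ m x = fromℕ< (m%n<n x m)

_-ₘ_ : {m : ℕ} .{{_ : NonZero m}} → Fin m → Fin m → Fin m
_-ₘ_ {m} x y = reduceₘ m (toℕ x + (m ∸ toℕ y))

ψ : (m : ℕ) .{{_ : NonZero m}} → ℕ → Fin m → Fin m
ψ m l x = reduceₘ m (l * toℕ x)

-- Γ = DiCay(ℤ_m, S_1,…,S_k) is given by the connection sets S : Fin k → Subset m.
-- Reduced: no nonzero h with S_i + h = S_i for all i
-- (x ∈ S_i + h  iff  x - h ∈ S_i).
Reduced : {m k : ℕ} .{{_ : NonZero m}} → (Fin k → Subset m) → Set
Reduced {m} {k} S =
  (h : Fin m) → toℕ h ≢ 0 →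
  ¬ ((i : Fin k) (x : Fin m) → ((x -ₘ h) ∈ S i) ⇔ (x ∈ S i))

-- (σ_i)_{i∈ℤ} ∈ Aut_Ch(Γ): (v,i) ↦ (σ_i v, i) is a colour-preserving
-- automorphism of Ch(Γ), i.e. each σ_i is a permutation and for all i, v, w, j:
-- colour-j edge (v,i)→(w,i+1) iff colour-j edge (σ_i v,i)→(σ_{i+1} w,i+1).
IsChainAut : {m k : ℕ} .{{_ : NonZero m}} → (Fin k → Subset m) →
             (ℤ → Permutation′ m) → Set
IsChainAut {m} {k} S σ =
  (i : ℤ) (v w : Fin m) (j : Fin k) →
  ((w -ₘ v) ∈ S j) ⇔ (((σ (i +ℤ + 1) ⟨$⟩ʳ w) -ₘ (σ i ⟨$⟩ʳ v)) ∈ S j)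

InAutCh : {m k : ℕ} .{{_ : NonZero m}} → (Fin k → Subset m) → (Fin m → Fin m) → Set
InAutCh {m} S φ =
  Σ (ℤ → Permutation′ m) λ σ → IsChainAut S σ × ((σ (+ 0) ⟨$⟩ʳ_) ≗ φ)

-- Graph of γ : Aut^Ch(Γ) → Aut^Ch(Γ), γ(σ_0) = σ_1
-- (a function on Aut^Ch(Γ) since Γ is reduced).
GammaRel : {m k : ℕ} .{{_ : NonZero m}} → (Fin k → Subset m) →
           (Fin m → Fin m) → (Fin m → Fin m) → Set
GammaRel {m} S φ φ' =
  Σ (ℤ → Permutation′ m) λ σ →
    IsChainAut S σ × ((σ (+ 0) ⟨$⟩ʳ_) ≗ φ) × ((σ (+ 1) ⟨$⟩ʳ_) ≗ φ')

GammaPow : {m k : ℕ} .{{_ : NonZero m}} → (Fin k → Subset m) → ℕ →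
           (Fin m → Fin m) → (Fin m → Fin m) → Set
GammaPow S zero    φ φ' = φ ≗ φ'
GammaPow {m} S (suc n) φ φ' =
  Σ (Fin m → Fin m) λ χ → GammaRel S φ χ × GammaPow S n χ φ'

-- Call (f , g) a P-step if w - v ∈ P ⇔ g w - f v ∈ P for all v, w, so that the levels (σ₀ , σ₁)
-- of a chain automorphism form an Sⱼ-step for every colour j. A P-step whose source is a
-- permutation is intertwined by the adjacency operator A u x = Σ_{s ∈ P} u (x - s) on ℕ-valued
-- functions, hence a walk of n such steps from f to g satisfies Aⁿ u ∘ g = Aⁿ (u ∘ f). For a
-- prime p, A is a sum of commuting translations T_s, so Aᵖ ≡ Σ_{s ∈ P} T_{ps} (mod p); evaluated
-- on point masses, the right-hand side is the 0/1 indicator of the dilation pP (ψ_p is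
-- injective), so a walk of p steps is a single pP-step. Factorising l, the walk φ ↦ φₗ of γˡ is
-- an lSⱼ-step; conjugating it by ψ_l gives the Sⱼ-step (φ₀ , ψ_l⁻¹ ∘ φₗ ∘ ψ_l). But (φ₀ , φ₁) is
-- an Sⱼ-step too, and in a reduced digraph a step is determined by its surjective source.

module Submission where

open import Defs
open import Data.Nat using (ℕ; NonZero)
open import Data.Nat.Coprimality using (Coprime)
open import Data.Fin using (Fin)
open import Data.Fin.Subset using (Subset)
open import Function using (_∘_)
open import Relation.Binary.PropositionalEquality using (_≗_)

open import Algebra.Bundles using (Semiring)
open import Data.Bool.Base using (Bool; true; false; if_then_else_)
open import Data.Empty using (⊥-elim)
open import Data.Fin.Base using (toℕ; zero; suc; fromℕ; inject₁; punchIn)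
open import Data.Fin.Permutation using (Permutation′; permutation; _⟨$⟩ʳ_; _⟨$⟩ˡ_; inverseˡ; inverseʳ)
open import Data.Fin.Properties
  using (toℕ-injective; toℕ<n; toℕ-fromℕ<; toℕ-fromℕ; toℕ-inject₁; punchInᵢ≢i; any?; _≟_)
open import Data.Fin.Subset using (_∈_)
open import Data.Fin.Subset.Properties using (_∈?_)
import Data.Integer.Base as ℤ
open import Data.List.Base using ([]; _∷_)
open import Data.List.Relation.Unary.All using (All; []; _∷_)
open import Data.Nat.Base using (zero; suc; _+_; _*_; _∸_; _<_; z<s; s<s; >-nonZero⁻¹; nonTrivial⇒n>1)
open import Data.Nat.Combinatorics using (_C_; nC1≡n; nCn≡1; nCk+nC[k+1]≡[n+1]C[k+1])
open import Data.Nat.Combinatorics.Specification using (k>n⇒nCk≡0)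
open import Data.Nat.Coprimality using (coprime-Bézout; coprime-divisor; prime⇒coprime; 0-coprimeTo-m⇒m≡1)
open import Data.Nat.DivMod
  using (_%_; m%n<n; m%n%n≡m%n; [m+n]%n≡m%n; [m+kn]%n≡m%n; %-distribˡ-+; %-distribˡ-*; %-remove-+ʳ; m<n⇒m%n≡m)
open import Data.Nat.Divisibility using (_∣_; divides; _∣0; ∣m∣n⇒∣m+n; ∣m⇒∣m*n; ∣n⇒∣m*n)
open import Data.Nat.GCD using (module Bézout)
open import Data.Nat.ListAction using (product)
open import Data.Nat.Primality using (Prime; prime⇒nonZero; prime⇒nonTrivial)
open import Data.Nat.Primality.Factorisation using (factorise)
import Data.Nat.Properties as ℕ
open import Data.Nat.Properties
  using ( +-comm; +-assoc; +-identityʳ; *-comm; *-assoc; *-identityˡ; *-identityʳ; *-zeroʳ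
        ; *-distribˡ-+; n∸n≡0; m+[n∸m]≡n; m∸n+n≡m; <⇒≤; +-commutativeSemigroup; +-0-commutativeMonoid)
open import Data.Nat.Tactic.RingSolver using (solve-∀)
open import Data.Product using (Σ; ∃; _×_; _,_; proj₁; proj₂; map₂)
open import Data.Vec.Functional using (init; removeAt)
open import Function using (_$_; flip; id)
open import Function.Bundles using (_⇔_; mk⇔)
open import Function.Properties.Equivalence using (⇔-setoid) renaming (trans to ⇔-trans; sym to ⇔-sym)
open import Level using (0ℓ)
open import Relation.Binary.Core using (Rel)
open import Relation.Binary.PropositionalEquality
  using (_≡_; _≢_; refl; sym; trans; cong; cong₂; subst; module ≡-Reasoning)
import Relation.Binary.Reasoning.Setoid
open import Relation.Nullary using (¬_; Dec; does; yes; no)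
open import Relation.Nullary.Decidable using (_×-dec_; dec-true; dec-false; does-⇔)
open import Relation.Unary using (Decidable)

open import Algebra.Properties.CommutativeSemigroup +-commutativeSemigroup
  using (xy∙z≈xz∙y; x∙yz≈xz∙y; interchange)
open import Algebra.Properties.CommutativeMonoid.Sum +-0-commutativeMonoid
  using (sum; sum-syntax; sum-init-last; sum-remove; sum-cong-≗; sum-replicate-zero; ∑-permute)

module ⇔-Reasoning = Relation.Binary.Reasoning.Setoid (⇔-setoid 0ℓ)

-- Congruences of natural numbers

infix 4 _≡_mod_
_≡_mod_ : ℕ → ℕ → (n : ℕ) → .{{NonZero n}} → Set
a ≡ b mod n = a % n ≡ b % n

module _ {n : ℕ} .{{_ : NonZero n}} where

  %-≡mod : ∀ a → a % n ≡ a mod n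
  %-≡mod a = m%n%n≡m%n a n

  +-cong-mod : ∀ {a b c d} → a ≡ b mod n → c ≡ d mod n → a + c ≡ b + d mod n
  +-cong-mod {a} {b} {c} {d} a≡b c≡d = begin
    (a + c) % n             ≡⟨ %-distribˡ-+ a c n ⟩
    (a % n + c % n) % n     ≡⟨ cong₂ (λ x y → (x + y) % n) a≡b c≡d ⟩
    (b % n + d % n) % n     ≡⟨ %-distribˡ-+ b d n ⟨
    (b + d) % n             ∎
    where open ≡-Reasoning

  *-cong-mod : ∀ {a b c d} → a ≡ b mod n → c ≡ d mod n → a * c ≡ b * d mod n
  *-cong-mod {a} {b} {c} {d} a≡b c≡d = begin
    (a * c) % n             ≡⟨ %-distribˡ-* a c n ⟩
    (a % n * (c % n)) % n   ≡⟨ cong₂ (λ x y → (x * y) % n) a≡b c≡d ⟩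
    (b % n * (d % n)) % n   ≡⟨ %-distribˡ-* b d n ⟨
    (b * d) % n             ∎
    where open ≡-Reasoning

  +-cancelʳ-mod : ∀ {a b} c → a + c ≡ b + c mod n → a ≡ b mod n
  +-cancelʳ-mod {a} {b} c a+c≡b+c = begin
    a % n                   ≡⟨ cong (_% n) (+-identityʳ a) ⟨
    (a + 0) % n             ≡⟨ +-cong-mod {a} {a} refl c+c⁻≡0 ⟨
    (a + (c + c⁻)) % n      ≡⟨ cong (_% n) (+-assoc a c c⁻) ⟨
    (a + c + c⁻) % n        ≡⟨ +-cong-mod a+c≡b+c refl ⟩
    (b + c + c⁻) % n        ≡⟨ cong (_% n) (+-assoc b c c⁻) ⟩
    (b + (c + c⁻)) % n      ≡⟨ +-cong-mod {b} {b} refl c+c⁻≡0 ⟩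
    (b + 0) % n             ≡⟨ cong (_% n) (+-identityʳ b) ⟩
    b % n                   ∎
    where
    open ≡-Reasoning
    c⁻ = n ∸ c % n
    c+c⁻≡0 : c + c⁻ ≡ 0 mod n
    c+c⁻≡0 = begin
      (c + c⁻) % n          ≡⟨ +-cong-mod (%-≡mod c) refl ⟨
      (c % n + c⁻) % n      ≡⟨ cong (_% n) (m+[n∸m]≡n (<⇒≤ (m%n<n c n))) ⟩
      n % n                 ≡⟨ [m+n]%n≡m%n 0 n ⟩
      0 % n                 ∎

  1≢0-mod : 1 < n → ¬ (1 ≡ 0 mod n)
  1≢0-mod 1<n 1≡0 with () ← trans (sym (m<n⇒m%n≡m 1<n)) (trans 1≡0 (m<n⇒m%n≡m (>-nonZero⁻¹ n)))

coprime⇒inverse-mod : ∀ {l} m .{{_ : NonZero m}} → Coprime l m → ∃ λ k → k * l ≡ 1 mod m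
coprime⇒inverse-mod {l} m@(suc m-1) l⊥m with coprime-Bézout l⊥m
... | Bézout.+- x y 1+ym≡xl = x , (begin
  (x * l) % m       ≡⟨ cong (_% m) 1+ym≡xl ⟨
  (1 + y * m) % m   ≡⟨ [m+kn]%n≡m%n 1 y m ⟩
  1 % m             ∎)
  where open ≡-Reasoning
-- Here x l ≡ -1, so x (m - 1) is the inverse.
... | Bézout.-+ x y 1+xl≡ym = x * m-1 , (begin
  (x * m-1 * l) % m                ≡⟨ [m+kn]%n≡m%n (x * m-1 * l) 1 m ⟨
  (x * m-1 * l + 1 * m) % m        ≡⟨ cong (_% m) (expand x l m-1) ⟩
  ((1 + x * l) * m-1 + 1) % m      ≡⟨ cong (λ t → (t * m-1 + 1) % m) 1+xl≡ym ⟩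
  (y * m * m-1 + 1) % m            ≡⟨ cong (_% m) (regroup y m-1) ⟩
  (1 + y * m-1 * m) % m            ≡⟨ [m+kn]%n≡m%n 1 (y * m-1) m ⟩
  1 % m                            ∎)
  where
  open ≡-Reasoning
  expand : ∀ x l k → x * k * l + 1 * suc k ≡ (1 + x * l) * k + 1
  expand = solve-∀
  regroup : ∀ y k → y * suc k * k + 1 ≡ 1 + y * k * suc k
  regroup = solve-∀

-- Binomial coefficients modulo a prime

[1+k]*[1+n]C[1+k]≡[1+n]*nCk : ∀ n k → suc k * (suc n C suc k) ≡ suc n * (n C k)
[1+k]*[1+n]C[1+k]≡[1+n]*nCk n zero = begin
  1 * (suc n C 1)   ≡⟨ *-identityˡ _ ⟩
  suc n C 1         ≡⟨ nC1≡n (suc n) ⟩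
  suc n             ≡⟨ *-identityʳ (suc n) ⟨
  suc n * 1         ∎
  where open ≡-Reasoning
[1+k]*[1+n]C[1+k]≡[1+n]*nCk zero (suc k) = begin
  suc (suc k) * (1 C suc (suc k))   ≡⟨ cong (suc (suc k) *_) (k>n⇒nCk≡0 {1} {suc (suc k)} (s<s z<s)) ⟩
  suc (suc k) * 0                   ≡⟨ *-zeroʳ (suc (suc k)) ⟩
  0                                 ≡⟨ cong (1 *_) (k>n⇒nCk≡0 {0} {suc k} z<s) ⟨
  1 * (0 C suc k)                   ∎
  where open ≡-Reasoning
[1+k]*[1+n]C[1+k]≡[1+n]*nCk (suc n) (suc k) = begin
  suc (suc k) * (suc (suc n) C suc (suc k))
    ≡⟨ cong (suc (suc k) *_) (nCk+nC[k+1]≡[n+1]C[k+1] (suc n) (suc k)) ⟨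
  suc (suc k) * (A + B)
    ≡⟨ *-distribˡ-+ (suc (suc k)) A B ⟩
  (A + suc k * A) + suc (suc k) * B
    ≡⟨ cong₂ (λ s t → (A + s) + t) ([1+k]*[1+n]C[1+k]≡[1+n]*nCk n k) ([1+k]*[1+n]C[1+k]≡[1+n]*nCk n (suc k)) ⟩
  (A + suc n * (n C k)) + suc n * (n C suc k)
    ≡⟨ +-assoc A _ _ ⟩
  A + (suc n * (n C k) + suc n * (n C suc k))
    ≡⟨ cong (A +_) (*-distribˡ-+ (suc n) (n C k) (n C suc k)) ⟨
  A + suc n * (n C k + n C suc k)
    ≡⟨ cong (λ t → A + suc n * t) (nCk+nC[k+1]≡[n+1]C[k+1] n k) ⟩
  A + suc n * A
    ∎
  where
  open ≡-Reasoning
  A = suc n C suc k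
  B = suc n C suc (suc k)

prime∣pCk : ∀ {p k} → Prime p → 0 < k → k < p → p ∣ p C k
prime∣pCk {suc n} {suc k} p-prime _ k<p = coprime-divisor (prime⇒coprime p-prime k<p)
  (divides (n C k) (trans ([1+k]*[1+n]C[1+k]≡[1+n]*nCk n k) (*-comm (suc n) (n C k))))

∣-sum : ∀ {d n} (f : Fin n → ℕ) → (∀ i → d ∣ f i) → d ∣ ∑[ i < n ] f i
∣-sum {d} {zero}  f d∣f = d ∣0
∣-sum {d} {suc n} f d∣f = ∣m∣n⇒∣m+n (d∣f zero) (∣-sum (f ∘ suc) (d∣f ∘ suc))

∑pCk*fk≡f0+fp : ∀ {p} .{{_ : NonZero p}} → Prime p → (f : Fin (suc p) → ℕ) →
                ∑[ k < suc p ] ((p C toℕ k) * f k) ≡ f zero + f (fromℕ p) mod p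
∑pCk*fk≡f0+fp {p@(suc q)} p-prime f = begin
  (∑[ k < suc p ] F k) % p           ≡⟨ cong (_% p) split ⟩
  (f zero + f (fromℕ p) + M) % p     ≡⟨ %-remove-+ʳ (f zero + f (fromℕ p)) (∣-sum (init (F ∘ suc)) p∣middle) ⟩
  (f zero + f (fromℕ p)) % p         ∎
  where
  open ≡-Reasoning
  F : Fin (suc p) → ℕ
  F k = (p C toℕ k) * f k
  M = ∑[ k < q ] init (F ∘ suc) k
  p∣middle : ∀ k → p ∣ init (F ∘ suc) k
  p∣middle k = ∣m⇒∣m*n (f (suc (inject₁ k)))
    (prime∣pCk {k = suc (toℕ (inject₁ k))} p-prime z<s (s<s (subst (_< q) (sym (toℕ-inject₁ k)) (toℕ<n k))))
  Fp≡fp : F (fromℕ p) ≡ f (fromℕ p)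
  Fp≡fp = trans (cong (λ t → (p C t) * f (fromℕ p)) (toℕ-fromℕ p))
                (trans (cong (_* f (fromℕ p)) (nCn≡1 p)) (*-identityˡ (f (fromℕ p))))
  split : ∑[ k < suc p ] F k ≡ f zero + f (fromℕ p) + M
  split = begin
    F zero + ∑[ k < p ] F (suc k)     ≡⟨ cong₂ _+_ (+-identityʳ (f zero)) (sum-init-last (F ∘ suc)) ⟩
    f zero + (M + F (fromℕ p))        ≡⟨ cong (λ t → f zero + (M + t)) Fp≡fp ⟩
    f zero + (M + f (fromℕ p))        ≡⟨ x∙yz≈xz∙y (f zero) M _ ⟩
    f zero + f (fromℕ p) + M          ∎

indicator : ∀ {a} {A : Set a} → Dec A → ℕ
indicator a? = if does a? then 1 else 0

module _ {a} {A : Set a} where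

  indicator-yes : (a? : Dec A) → A → indicator a? ≡ 1
  indicator-yes a? x = cong (λ t → if t then 1 else 0) (dec-true a? x)

  indicator-no : (a? : Dec A) → ¬ A → indicator a? ≡ 0
  indicator-no a? ¬x = cong (λ t → if t then 1 else 0) (dec-false a? ¬x)

  module _ {b} {B : Set b} where

    indicator-⇔ : A ⇔ B → (a? : Dec A) (b? : Dec B) → indicator a? ≡ indicator b?
    indicator-⇔ A⇔B a? b? = cong (λ t → if t then 1 else 0) (does-⇔ A⇔B a? b?)

    indicator-injective-mod : ∀ {n} .{{_ : NonZero n}} → 1 < n →
                              (a? : Dec A) (b? : Dec B) → indicator a? ≡ indicator b? mod n → A ⇔ B
    indicator-injective-mod 1<n (yes x) (yes y) _   = mk⇔ (λ _ → y) (λ _ → x)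
    indicator-injective-mod 1<n (no ¬x) (no ¬y) _   = mk⇔ (⊥-elim ∘ ¬x) (⊥-elim ∘ ¬y)
    indicator-injective-mod 1<n (yes _) (no _)  1≡0 = ⊥-elim (1≢0-mod 1<n 1≡0)
    indicator-injective-mod 1<n (no _)  (yes _) 0≡1 = ⊥-elim (1≢0-mod 1<n (sym 0≡1))

∑-zero : ∀ {n} (f : Fin n → ℕ) → (∀ i → f i ≡ 0) → ∑[ i < n ] f i ≡ 0
∑-zero {n} f f≡0 = trans (sum-cong-≗ f≡0) (sum-replicate-zero n)

∑-single : ∀ {n} (f : Fin n → ℕ) i → (∀ j → j ≢ i → f j ≡ 0) → ∑[ j < n ] f j ≡ f i
∑-single {suc n} f i f≡0 = begin
  ∑[ j < suc n ] f j         ≡⟨ sum-remove {i = i} f ⟩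
  f i + sum (removeAt f i)   ≡⟨ cong (f i +_) (∑-zero (removeAt f i) (λ j → f≡0 (punchIn i j) (punchInᵢ≢i i j))) ⟩
  f i + 0                    ≡⟨ +-identityʳ (f i) ⟩
  f i                        ∎
  where open ≡-Reasoning

∑-indicator-unique : ∀ {n} {Q : Fin n → Set} (Q? : Decidable Q) → (∀ {i j} → Q i → Q j → i ≡ j) →
                     ∑[ i < n ] indicator (Q? i) ≡ indicator (any? Q?)
∑-indicator-unique Q? Q-unique with any? Q?
... | yes (i , Qi) = trans (∑-single _ i λ j j≢i → indicator-no (Q? j) (j≢i ∘ flip Q-unique Qi))
                           (indicator-yes (Q? i) Qi)
... | no ∄Q        = ∑-zero _ λ i → indicator-no (Q? i) (λ Qi → ∄Q (i , Qi))

Walk : ∀ {A B : Set} → Rel (A → B) 0ℓ → ℕ → Rel (A → B) 0ℓ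
Walk R zero    f g = f ≗ g
Walk R (suc n) f g = ∃ λ h → R f h × Walk R n h g

Walk-map : ∀ {A B : Set} {R R' : Rel (A → B) 0ℓ} → (∀ {f g} → R f g → R' f g) →
           ∀ n {f g} → Walk R n f g → Walk R' n f g
Walk-map R⇒R' zero    f≗g              = f≗g
Walk-map R⇒R' (suc n) (h , Rfh , walk) = h , R⇒R' Rfh , Walk-map R⇒R' n walk

Walk-split : ∀ {A B : Set} {R : Rel (A → B) 0ℓ} a {b f g} → Walk R (a + b) f g →
             ∃ λ h → Walk R a f h × Walk R b h g
Walk-split zero    walk             = _ , (λ _ → refl) , walk
Walk-split (suc a) (h , Rfh , walk) =
  let (k , walk₁ , walk₂) = Walk-split a walk in k , (h , Rfh , walk₁) , walk₂

Walk-blocks : ∀ {A B : Set} {R : Rel (A → B) 0ℓ} p {q f g} → Walk R (p * q) f g → Walk (Walk R q) p f g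
Walk-blocks zero    f≗g      = f≗g
Walk-blocks (suc p) {q} walk =
  let (h , walk₁ , walk₂) = Walk-split q walk in h , walk₁ , Walk-blocks p walk₂

module _ {m : ℕ} .{{_ : NonZero m}} where

  -- Arithmetic in ℤ_m

  toℕ-reduceₘ : ∀ a → toℕ (reduceₘ m a) ≡ a mod m
  toℕ-reduceₘ a = trans (cong (_% m) (toℕ-fromℕ< (m%n<n a m))) (%-≡mod a)

  toℕ-injective-mod : {x y : Fin m} → toℕ x ≡ toℕ y mod m → x ≡ y
  toℕ-injective-mod {x} {y} x≡y = toℕ-injective (begin
    toℕ x       ≡⟨ m<n⇒m%n≡m (toℕ<n x) ⟨
    toℕ x % m   ≡⟨ x≡y ⟩
    toℕ y % m   ≡⟨ m<n⇒m%n≡m (toℕ<n y) ⟩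
    toℕ y       ∎)
    where open ≡-Reasoning

  [x-ₘy]+y≡x : (x y : Fin m) → toℕ (x -ₘ y) + toℕ y ≡ toℕ x mod m
  [x-ₘy]+y≡x x y = begin
    (toℕ (x -ₘ y) + toℕ y) % m         ≡⟨ +-cong-mod (toℕ-reduceₘ (toℕ x + (m ∸ toℕ y))) refl ⟩
    (toℕ x + (m ∸ toℕ y) + toℕ y) % m  ≡⟨ cong (_% m) (+-assoc (toℕ x) _ _) ⟩
    (toℕ x + (m ∸ toℕ y + toℕ y)) % m  ≡⟨ cong (λ t → (toℕ x + t) % m) (m∸n+n≡m (<⇒≤ (toℕ<n y))) ⟩
    (toℕ x + m) % m                    ≡⟨ [m+n]%n≡m%n (toℕ x) m ⟩
    toℕ x % m                          ∎
    where open ≡-Reasoning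

  z+y≡x⇒z≡x-ₘy : {x y z : Fin m} → toℕ z + toℕ y ≡ toℕ x mod m → z ≡ x -ₘ y
  z+y≡x⇒z≡x-ₘy {x} {y} z+y≡x =
    toℕ-injective-mod (+-cancelʳ-mod (toℕ y) (trans z+y≡x (sym ([x-ₘy]+y≡x x y))))

  x-ₘy≡z⇒x-ₘz≡y : {x y z : Fin m} → x -ₘ y ≡ z → x -ₘ z ≡ y
  x-ₘy≡z⇒x-ₘz≡y {x} {y} refl =
    sym (z+y≡x⇒z≡x-ₘy (trans (cong (_% m) (+-comm (toℕ y) _)) ([x-ₘy]+y≡x x y)))

  x-ₘ[x-ₘy]≡y : (x y : Fin m) → x -ₘ (x -ₘ y) ≡ y
  x-ₘ[x-ₘy]≡y x y = x-ₘy≡z⇒x-ₘz≡y refl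

  [x-ₘy]-ₘz≡[x-ₘz]-ₘy : (x y z : Fin m) → (x -ₘ y) -ₘ z ≡ (x -ₘ z) -ₘ y
  [x-ₘy]-ₘz≡[x-ₘz]-ₘy x y z = z+y≡x⇒z≡x-ₘy (+-cancelʳ-mod (toℕ z) (begin
    (toℕ ((x -ₘ y) -ₘ z) + toℕ y + toℕ z) % m   ≡⟨ cong (_% m) (xy∙z≈xz∙y (toℕ ((x -ₘ y) -ₘ z)) _ _) ⟩
    (toℕ ((x -ₘ y) -ₘ z) + toℕ z + toℕ y) % m   ≡⟨ +-cong-mod ([x-ₘy]+y≡x (x -ₘ y) z) refl ⟩
    (toℕ (x -ₘ y) + toℕ y) % m                  ≡⟨ [x-ₘy]+y≡x x y ⟩
    toℕ x % m                                   ≡⟨ [x-ₘy]+y≡x x z ⟨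
    (toℕ (x -ₘ z) + toℕ z) % m                  ∎))
    where open ≡-Reasoning

  [x-ₘy]-ₘ[x-ₘz]≡z-ₘy : (x y z : Fin m) → (x -ₘ y) -ₘ (x -ₘ z) ≡ z -ₘ y
  [x-ₘy]-ₘ[x-ₘz]≡z-ₘy x y z =
    trans ([x-ₘy]-ₘz≡[x-ₘz]-ₘy x y (x -ₘ z)) (cong (_-ₘ y) (x-ₘ[x-ₘy]≡y x z))

  toℕ[x-ₘy]≡0⇒x≡y : {x y : Fin m} → toℕ (x -ₘ y) ≡ 0 → x ≡ y
  toℕ[x-ₘy]≡0⇒x≡y {x} {y} x-ₘy≡0 =
    toℕ-injective-mod (trans (sym ([x-ₘy]+y≡x x y)) (cong (λ t → (t + toℕ y) % m) x-ₘy≡0))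

  toℕ-ψ : ∀ l (x : Fin m) → toℕ (ψ m l x) ≡ l * toℕ x mod m
  toℕ-ψ l x = toℕ-reduceₘ (l * toℕ x)

  ψ-cong-mod : ∀ {k l} → k ≡ l mod m → (x : Fin m) → ψ m k x ≡ ψ m l x
  ψ-cong-mod {k} {l} k≡l x = toℕ-injective-mod (begin
    toℕ (ψ m k x) % m   ≡⟨ toℕ-ψ k x ⟩
    (k * toℕ x) % m     ≡⟨ *-cong-mod k≡l refl ⟩
    (l * toℕ x) % m     ≡⟨ toℕ-ψ l x ⟨
    toℕ (ψ m l x) % m   ∎)
    where open ≡-Reasoning

  ψ-identity : (x : Fin m) → ψ m 1 x ≡ x
  ψ-identity x = toℕ-injective-mod (trans (toℕ-ψ 1 x) (cong (_% m) (*-identityˡ (toℕ x))))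

  ψ-∘ : ∀ k l (x : Fin m) → ψ m k (ψ m l x) ≡ ψ m (k * l) x
  ψ-∘ k l x = toℕ-injective-mod (begin
    toℕ (ψ m k (ψ m l x)) % m   ≡⟨ toℕ-ψ k (ψ m l x) ⟩
    (k * toℕ (ψ m l x)) % m     ≡⟨ *-cong-mod {a = k} refl (toℕ-ψ l x) ⟩
    (k * (l * toℕ x)) % m       ≡⟨ cong (_% m) (*-assoc k l (toℕ x)) ⟨
    (k * l * toℕ x) % m         ≡⟨ toℕ-ψ (k * l) x ⟨
    toℕ (ψ m (k * l) x) % m     ∎)
    where open ≡-Reasoning

  ψ-inverseˡ : ∀ {k l} → k * l ≡ 1 mod m → (x : Fin m) → ψ m k (ψ m l x) ≡ x
  ψ-inverseˡ {k} {l} kl≡1 x = trans (ψ-∘ k l x) (trans (ψ-cong-mod kl≡1 x) (ψ-identity x))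

  ψ-inverseʳ : ∀ {k l} → k * l ≡ 1 mod m → (x : Fin m) → ψ m l (ψ m k x) ≡ x
  ψ-inverseʳ {k} {l} kl≡1 = ψ-inverseˡ {l} {k} (trans (cong (_% m) (*-comm l k)) kl≡1)

  ψ-injective : ∀ {l} → Coprime l m → {x y : Fin m} → ψ m l x ≡ ψ m l y → x ≡ y
  ψ-injective {l} l⊥m {x} {y} ψx≡ψy =
    trans (sym (ψ-inverseˡ {k} {l} kl≡1 x)) (trans (cong (ψ m k) ψx≡ψy) (ψ-inverseˡ {k} {l} kl≡1 y))
    where
    k = proj₁ (coprime⇒inverse-mod m l⊥m)
    kl≡1 = proj₂ (coprime⇒inverse-mod m l⊥m)

  ψ-distrib-ₘ : ∀ l (x y : Fin m) → ψ m l (x -ₘ y) ≡ ψ m l x -ₘ ψ m l y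
  ψ-distrib-ₘ l x y = z+y≡x⇒z≡x-ₘy (begin
    (toℕ (ψ m l (x -ₘ y)) + toℕ (ψ m l y)) % m   ≡⟨ +-cong-mod (toℕ-ψ l (x -ₘ y)) (toℕ-ψ l y) ⟩
    (l * toℕ (x -ₘ y) + l * toℕ y) % m           ≡⟨ cong (_% m) (*-distribˡ-+ l _ _) ⟨
    (l * (toℕ (x -ₘ y) + toℕ y)) % m             ≡⟨ *-cong-mod {a = l} refl ([x-ₘy]+y≡x x y) ⟩
    (l * toℕ x) % m                              ≡⟨ toℕ-ψ l x ⟨
    toℕ (ψ m l x) % m                            ∎)
    where open ≡-Reasoning

  x-ₘψ0y≡x : (x y : Fin m) → x -ₘ ψ m 0 y ≡ x
  x-ₘψ0y≡x x y = sym (z+y≡x⇒z≡x-ₘy (trans (+-cong-mod {a = toℕ x} refl (toℕ-ψ 0 y))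
                                          (cong (_% m) (+-identityʳ (toℕ x)))))

  [x-ₘy]-ₘψky≡x-ₘψ[1+k]y : ∀ k (x y : Fin m) → (x -ₘ y) -ₘ ψ m k y ≡ x -ₘ ψ m (suc k) y
  [x-ₘy]-ₘψky≡x-ₘψ[1+k]y k x y = z+y≡x⇒z≡x-ₘy (begin
    (toℕ z + toℕ (ψ m (suc k) y)) % m    ≡⟨ +-cong-mod {a = toℕ z} refl (toℕ-ψ (suc k) y) ⟩
    (toℕ z + (toℕ y + k * toℕ y)) % m    ≡⟨ cong (_% m) (x∙yz≈xz∙y (toℕ z) (toℕ y) _) ⟩
    (toℕ z + k * toℕ y + toℕ y) % m      ≡⟨ +-cong-mod (+-cong-mod {a = toℕ z} refl (toℕ-ψ k y)) refl ⟨
    (toℕ z + toℕ (ψ m k y) + toℕ y) % m  ≡⟨ +-cong-mod ([x-ₘy]+y≡x (x -ₘ y) (ψ m k y)) refl ⟩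
    (toℕ (x -ₘ y) + toℕ y) % m           ≡⟨ [x-ₘy]+y≡x x y ⟩
    toℕ x % m                            ∎)
    where
    open ≡-Reasoning
    z = (x -ₘ y) -ₘ ψ m k y

  -- Steps and dilations

  record Step (P : Fin m → Set) (f g : Fin m → Fin m) : Set where
    constructor mkStep
    field
      diff-⇔ : ∀ v w → P (w -ₘ v) ⇔ P (g w -ₘ f v)
  open Step public

  IsPermutation : (Fin m → Fin m) → Set
  IsPermutation f = Σ (Permutation′ m) λ π → (π ⟨$⟩ʳ_) ≗ f

  PermStep : (Fin m → Set) → (Fin m → Fin m) → (Fin m → Fin m) → Set
  PermStep P f g = IsPermutation f × Step P f g

  IsPermutation⇒surjective : ∀ {f} → IsPermutation f → ∀ c → ∃ λ v → f v ≡ c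
  IsPermutation⇒surjective (π , π≗f) c = π ⟨$⟩ˡ c , trans (sym (π≗f _)) (inverseʳ π)

  IsPermutation⇒injective : ∀ {f} → IsPermutation f → ∀ {x y} → f x ≡ f y → x ≡ y
  IsPermutation⇒injective (π , π≗f) {x} {y} fx≡fy = begin
    x                      ≡⟨ inverseˡ π ⟨
    π ⟨$⟩ˡ (π ⟨$⟩ʳ x)      ≡⟨ cong (π ⟨$⟩ˡ_) (trans (π≗f x) (trans fx≡fy (sym (π≗f y)))) ⟩
    π ⟨$⟩ˡ (π ⟨$⟩ʳ y)      ≡⟨ inverseˡ π ⟩
    y                      ∎
    where open ≡-Reasoning

  infixr 7 _·_
  _·_ : ℕ → (Fin m → Set) → Fin m → Set
  (l · P) d = ∃ λ s → P s × ψ m l s ≡ d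

  ·-dec : ∀ l {P} → Decidable P → Decidable (l · P)
  ·-dec l P? d = any? λ s → P? s ×-dec (ψ m l s ≟ d)

  1·P⇔P : ∀ {P} d → (1 · P) d ⇔ P d
  1·P⇔P {P} d = mk⇔ (λ (s , Ps , ψs≡d) → subst P (trans (sym (ψ-identity s)) ψs≡d) Ps)
                    (λ Pd → d , Pd , ψ-identity d)

  ·-assoc : ∀ k l {P} d → (k · l · P) d ⇔ ((k * l) · P) d
  ·-assoc k l d = mk⇔
    (λ (_ , (s , Ps , ψs≡t) , ψt≡d) → s , Ps , trans (sym (ψ-∘ k l s)) (trans (cong (ψ m k) ψs≡t) ψt≡d))
    (λ (s , Ps , ψs≡d) → ψ m l s , (s , Ps , refl) , trans (ψ-∘ k l s) ψs≡d)

  ψx∈l·P⇔x∈P : ∀ {l P} → Coprime l m → (x : Fin m) → (l · P) (ψ m l x) ⇔ P x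
  ψx∈l·P⇔x∈P {P = P} l⊥m x = mk⇔ (λ (s , Ps , ψs≡ψx) → subst P (ψ-injective l⊥m ψs≡ψx) Ps)
                                  (λ Px → x , Px , refl)

  Step-cong : ∀ {P f f' g g'} → f ≗ f' → g ≗ g' → Step P f g → Step P f' g'
  Step-cong {P} f≗f' g≗g' (mkStep step) =
    mkStep λ v w → subst (λ d → P (w -ₘ v) ⇔ P d) (cong₂ _-ₘ_ (g≗g' w) (f≗f' v)) (step v w)

  Step-resp-⇔ : ∀ {P Q f g} → (∀ d → P d ⇔ Q d) → Step P f g → Step Q f g
  Step-resp-⇔ P⇔Q (mkStep step) = mkStep λ v w → ⇔-trans (⇔-sym (P⇔Q _)) (⇔-trans (step v w) (P⇔Q _))

  Step-conjugate : ∀ {l P f g f' g'} → Coprime l m → Step (l · P) f g →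
                   ψ m l ∘ f' ≗ f ∘ ψ m l → ψ m l ∘ g' ≗ g ∘ ψ m l → Step P f' g'
  Step-conjugate {l} {P} {f} {g} {f'} {g'} l⊥m (mkStep step) ψf'≗fψ ψg'≗gψ = mkStep λ v w → begin
    P (w -ₘ v)                              ≈⟨ ψx∈l·P⇔x∈P l⊥m (w -ₘ v) ⟨
    (l · P) (ψ m l (w -ₘ v))                ≡⟨ cong (l · P) (ψ-distrib-ₘ l w v) ⟩
    (l · P) (ψ m l w -ₘ ψ m l v)            ≈⟨ step (ψ m l v) (ψ m l w) ⟩
    (l · P) (g (ψ m l w) -ₘ f (ψ m l v))    ≡⟨ cong (l · P) (cong₂ _-ₘ_ (ψg'≗gψ w) (ψf'≗fψ v)) ⟨
    (l · P) (ψ m l (g' w) -ₘ ψ m l (f' v))  ≡⟨ cong (l · P) (ψ-distrib-ₘ l (g' w) (f' v)) ⟨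
    (l · P) (ψ m l (g' w -ₘ f' v))          ≈⟨ ψx∈l·P⇔x∈P l⊥m (g' w -ₘ f' v) ⟩
    P (g' w -ₘ f' v)                        ∎
    where open ⇔-Reasoning

  Step-unique : ∀ {k} {S : Fin k → Subset m} {f g g'} → Reduced S → (∀ c → ∃ λ v → f v ≡ c) →
                (∀ j → Step (_∈ S j) f g) → (∀ j → Step (_∈ S j) f g') → g ≗ g'
  Step-unique {S = S} {f} {g} {g'} reduced f-onto g-step g'-step x with toℕ (g x -ₘ g' x) ℕ.≟ 0
  ... | yes h≡0 = toℕ[x-ₘy]≡0⇒x≡y h≡0
  ... | no h≢0  = ⊥-elim (reduced h h≢0 h-invariant)
    where
    h = g x -ₘ g' x
    h-invariant : ∀ j y → (y -ₘ h) ∈ S j ⇔ y ∈ S j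
    h-invariant j y = begin
      (y -ₘ h) ∈ S j              ≡⟨ cong (λ z → (z -ₘ h) ∈ S j) y≡gx-fv ⟩
      ((g x -ₘ f v) -ₘ h) ∈ S j   ≡⟨ cong (_∈ S j) ([x-ₘy]-ₘ[x-ₘz]≡z-ₘy (g x) (f v) (g' x)) ⟩
      (g' x -ₘ f v) ∈ S j         ≈⟨ diff-⇔ (g'-step j) v x ⟨
      (x -ₘ v) ∈ S j              ≈⟨ diff-⇔ (g-step j) v x ⟩
      (g x -ₘ f v) ∈ S j          ≡⟨ cong (_∈ S j) y≡gx-fv ⟨
      y ∈ S j                     ∎
      where
      open ⇔-Reasoning
      v = proj₁ (f-onto (g x -ₘ y))
      y≡gx-fv : y ≡ g x -ₘ f v
      y≡gx-fv = trans (sym (x-ₘ[x-ₘy]≡y (g x) y)) (cong (g x -ₘ_) (sym (proj₂ (f-onto (g x -ₘ y)))))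

  -- Translation operators

  -- Additive operators on ℕ-valued functions form a semiring, to which the library's binomial
  -- theorem applies.
  record Op : Set where
    field
      app      : (Fin m → ℕ) → Fin m → ℕ
      app-cong : ∀ {u v} → u ≗ v → app u ≗ app v
      app-+    : ∀ u v → app (λ x → u x + v x) ≗ λ x → app u x + app v x
      app-0    : app (λ _ → 0) ≗ λ _ → 0
  open Op public

  infix 4 _≈ᵒ_
  _≈ᵒ_ : Op → Op → Set
  X ≈ᵒ Y = ∀ u → app X u ≗ app Y u

  infixl 6 _⊕_
  _⊕_ : Op → Op → Op
  app (X ⊕ Y) u x = app X u x + app Y u x
  app-cong (X ⊕ Y) u≗v x = cong₂ _+_ (app-cong X u≗v x) (app-cong Y u≗v x)
  app-+ (X ⊕ Y) u v x = trans (cong₂ _+_ (app-+ X u v x) (app-+ Y u v x))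
                              (interchange (app X u x) (app X v x) (app Y u x) (app Y v x))
  app-0 (X ⊕ Y) x = cong₂ _+_ (app-0 X x) (app-0 Y x)

  infixl 7 _⊛_
  _⊛_ : Op → Op → Op
  app (X ⊛ Y) u = app X (app Y u)
  app-cong (X ⊛ Y) u≗v = app-cong X (app-cong Y u≗v)
  app-+ (X ⊛ Y) u v x = trans (app-cong X (app-+ Y u v) x) (app-+ X (app Y u) (app Y v) x)
  app-0 (X ⊛ Y) x = trans (app-cong X (app-0 Y) x) (app-0 X x)

  𝟘 : Op
  app 𝟘 u x = 0
  app-cong 𝟘 _ _ = refl
  app-+ 𝟘 _ _ _ = refl
  app-0 𝟘 _ = refl

  𝟙 : Op
  app 𝟙 u = u
  app-cong 𝟙 u≗v = u≗v
  app-+ 𝟙 _ _ _ = refl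
  app-0 𝟙 _ = refl

  Op-semiring : Semiring 0ℓ 0ℓ
  Op-semiring = record
    { Carrier = Op
    ; _≈_ = _≈ᵒ_
    ; _+_ = _⊕_
    ; _*_ = _⊛_
    ; 0# = 𝟘
    ; 1# = 𝟙
    ; isSemiring = record
      { isSemiringWithoutAnnihilatingZero = record
        { +-isCommutativeMonoid = record
          { isMonoid = record
            { isSemigroup = record
              { isMagma = record
                { isEquivalence = record
                  { refl = λ _ _ → refl
                  ; sym = λ X≈Y u x → sym (X≈Y u x)
                  ; trans = λ X≈Y Y≈Z u x → trans (X≈Y u x) (Y≈Z u x) }
                ; ∙-cong = λ X≈X' Y≈Y' u x → cong₂ _+_ (X≈X' u x) (Y≈Y' u x) }
              ; assoc = λ X Y Z u x → +-assoc (app X u x) (app Y u x) (app Z u x) }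
            ; identity = (λ _ _ _ → refl) , (λ X u x → +-identityʳ (app X u x)) }
          ; comm = λ X Y u x → +-comm (app X u x) (app Y u x) }
        ; *-cong = λ {X} {X'} {Y} X≈X' Y≈Y' u x → trans (X≈X' (app Y u) x) (app-cong X' (Y≈Y' u) x)
        ; *-assoc = λ _ _ _ _ _ → refl
        ; *-identity = (λ _ _ _ → refl) , (λ _ _ _ → refl)
        ; distrib = (λ X Y Z u x → app-+ X (app Y u) (app Z u) x) , (λ _ _ _ _ _ → refl) }
      ; zero = (λ _ _ _ → refl) , (λ X u x → app-0 X x) } }

  open import Algebra.Properties.Semiring.Exp Op-semiring using (_^_; ^-homo-*; ^-congʳ)
  open import Algebra.Properties.Semiring.Sum Op-semiring using () renaming (sum to ∑ᵒ)
  open import Algebra.Properties.Semiring.Mult Op-semiring using () renaming (_×_ to _×ᵒ_)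
  import Algebra.Properties.Semiring.Binomial Op-semiring as Binomial

  app-∑ᵒ : ∀ {n} (X : Fin n → Op) u x → app (∑ᵒ X) u x ≡ ∑[ i < n ] app (X i) u x
  app-∑ᵒ {zero}  X u x = refl
  app-∑ᵒ {suc n} X u x = cong (app (X zero) u x +_) (app-∑ᵒ (X ∘ suc) u x)

  app-×ᵒ : ∀ k X u x → app (k ×ᵒ X) u x ≡ k * app X u x
  app-×ᵒ zero    X u x = refl
  app-×ᵒ (suc k) X u x = cong (app X u x +_) (app-×ᵒ k X u x)

  app-𝟘^ : ∀ k .{{_ : NonZero k}} u x → app (𝟘 ^ k) u x ≡ 0
  app-𝟘^ (suc k) u x = refl

  shift : Fin m → Op
  app (shift a) u x = u (x -ₘ a)
  app-cong (shift a) u≗v x = u≗v (x -ₘ a)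
  app-+ (shift a) _ _ _ = refl
  app-0 (shift a) _ = refl

  app-shift^ : ∀ a k u x → app (shift a ^ k) u x ≡ u (x -ₘ ψ m k a)
  app-shift^ a zero    u x = cong u (sym (x-ₘψ0y≡x x a))
  app-shift^ a (suc k) u x = trans (app-shift^ a k u (x -ₘ a)) (cong u ([x-ₘy]-ₘψky≡x-ₘψ[1+k]y k x a))

  shifts : ∀ {n} → (Fin n → Bool) → (Fin n → Fin m) → Op
  shifts {zero}  b c = 𝟘
  shifts {suc n} b c =
    if b zero then shift (c zero) ⊕ shifts (b ∘ suc) (c ∘ suc) else shifts (b ∘ suc) (c ∘ suc)

  app-shifts : ∀ {n} (b : Fin n → Bool) c u x →
               app (shifts b c) u x ≡ ∑[ i < n ] (if b i then u (x -ₘ c i) else 0)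
  app-shifts {zero}  b c u x = refl
  app-shifts {suc n} b c u x with b zero
  ... | true  = cong (u (x -ₘ c zero) +_) (app-shifts (b ∘ suc) (c ∘ suc) u x)
  ... | false = app-shifts (b ∘ suc) (c ∘ suc) u x

  shift⊛shifts≈shifts⊛shift : ∀ a {n} (b : Fin n → Bool) c → shift a ⊛ shifts b c ≈ᵒ shifts b c ⊛ shift a
  shift⊛shifts≈shifts⊛shift a b c u x = begin
    app (shifts b c) u (x -ₘ a)
      ≡⟨ app-shifts b c u (x -ₘ a) ⟩
    ∑[ i < _ ] (if b i then u ((x -ₘ a) -ₘ c i) else 0)
      ≡⟨ sum-cong-≗ (λ i → cong (λ y → if b i then u y else 0) ([x-ₘy]-ₘz≡[x-ₘz]-ₘy x a (c i))) ⟩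
    ∑[ i < _ ] (if b i then u ((x -ₘ c i) -ₘ a) else 0)
      ≡⟨ app-shifts b c (app (shift a) u) x ⟨
    app (shifts b c) (app (shift a) u) x
      ∎
    where open ≡-Reasoning

  frobenius : ∀ {p} .{{_ : NonZero p}} → Prime p → ∀ {n} (b : Fin n → Bool) c u x →
              app (shifts b c ^ p) u x ≡ app (shifts b (ψ m p ∘ c)) u x mod p
  frobenius {p} p-prime {zero}  b c u x = cong (_% p) (app-𝟘^ p u x)
  frobenius {p} p-prime {suc n} b c u x with b zero
  ... | false = frobenius p-prime (b ∘ suc) (c ∘ suc) u x
  ... | true  = begin
    app ((X ⊕ Y) ^ p) u x % p
      ≡⟨ cong (_% p) binomial-expansion ⟩
    (∑[ k < suc p ] ((p C toℕ k) * F k)) % p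
      ≡⟨ ∑pCk*fk≡f0+fp p-prime F ⟩
    (F zero + F (fromℕ p)) % p
      ≡⟨ +-cong-mod {n = p} (frobenius p-prime (b ∘ suc) (c ∘ suc) u x) (cong (_% p) Fp≡u[x-pc₀]) ⟩
    (app Y' u x + u (x -ₘ ψ m p (c zero))) % p
      ≡⟨ cong (_% p) (+-comm (app Y' u x) _) ⟩
    (u (x -ₘ ψ m p (c zero)) + app Y' u x) % p
      ∎
    where
    open ≡-Reasoning
    X = shift (c zero)
    Y = shifts (b ∘ suc) (c ∘ suc)
    Y' = shifts (b ∘ suc) (ψ m p ∘ c ∘ suc)
    F : Fin (suc p) → ℕ
    F k = app (Binomial.binomial X Y p k) u x
    binomial-expansion : app ((X ⊕ Y) ^ p) u x ≡ ∑[ k < suc p ] ((p C toℕ k) * F k)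
    binomial-expansion = begin
      app ((X ⊕ Y) ^ p) u x
        ≡⟨ Binomial.theorem X Y (shift⊛shifts≈shifts⊛shift (c zero) (b ∘ suc) (c ∘ suc)) p u x ⟩
      app (Binomial.binomialExpansion X Y p) u x
        ≡⟨ app-∑ᵒ (Binomial.binomialTerm X Y p) u x ⟩
      ∑[ k < suc p ] app (Binomial.binomialTerm X Y p k) u x
        ≡⟨ sum-cong-≗ (λ k → app-×ᵒ (p C toℕ k) (Binomial.binomial X Y p k) u x) ⟩
      ∑[ k < suc p ] ((p C toℕ k) * F k)
        ∎
    Fp≡u[x-pc₀] : F (fromℕ p) ≡ u (x -ₘ ψ m p (c zero))
    Fp≡u[x-pc₀] rewrite toℕ-fromℕ p | n∸n≡0 p = app-shift^ (c zero) p u x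

  -- Walks of steps

  Intertwines : Op → (Fin m → Fin m) → (Fin m → Fin m) → Set
  Intertwines X f g = ∀ u x → app X u (g x) ≡ app X (u ∘ f) x

  Intertwines-⊛ : ∀ {X Y f g h} → Intertwines X f h → Intertwines Y h g → Intertwines (Y ⊛ X) f g
  Intertwines-⊛ {X} {Y} X-fh Y-hg u x = trans (Y-hg (app X u) x) (app-cong Y (X-fh u) x)

  Intertwines-resp-≈ᵒ : ∀ {X Y f g} → X ≈ᵒ Y → Intertwines X f g → Intertwines Y f g
  Intertwines-resp-≈ᵒ {f = f} {g} X≈Y X-fg u x = trans (sym (X≈Y u (g x))) (trans (X-fg u x) (X≈Y (u ∘ f) x))

  adjacency : ∀ {P : Fin m → Set} → Decidable P → Op
  adjacency P? = shifts (λ i → does (P? i)) id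

  app-adjacency : ∀ {P} (P? : Decidable P) u x →
                  app (adjacency P?) u x ≡ ∑[ v < m ] (if does (P? (x -ₘ v)) then u v else 0)
  app-adjacency P? u x = begin
    app (adjacency P?) u x
      ≡⟨ app-shifts _ id u x ⟩
    ∑[ i < m ] (if does (P? i) then u (x -ₘ i) else 0)
      ≡⟨ ∑-permute _ reflection ⟩
    ∑[ v < m ] (if does (P? (x -ₘ v)) then u (x -ₘ (x -ₘ v)) else 0)
      ≡⟨ sum-cong-≗ (λ v → cong (λ y → if does (P? (x -ₘ v)) then u y else 0) (x-ₘ[x-ₘy]≡y x v)) ⟩
    ∑[ v < m ] (if does (P? (x -ₘ v)) then u v else 0)
      ∎
    where
    open ≡-Reasoning
    reflection : Permutation′ m
    reflection = permutation (x -ₘ_) (x -ₘ_) (x-ₘ[x-ₘy]≡y x) (x-ₘ[x-ₘy]≡y x)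

  PermStep⇒Intertwines : ∀ {P f g} (P? : Decidable P) → PermStep P f g → Intertwines (adjacency P?) f g
  PermStep⇒Intertwines {f = f} {g} P? ((π , π≗f) , mkStep step) u x = begin
    app (adjacency P?) u (g x)
      ≡⟨ app-adjacency P? u (g x) ⟩
    ∑[ v < m ] (if does (P? (g x -ₘ v)) then u v else 0)
      ≡⟨ ∑-permute _ π ⟩
    ∑[ v < m ] (if does (P? (g x -ₘ (π ⟨$⟩ʳ v))) then u (π ⟨$⟩ʳ v) else 0)
      ≡⟨ sum-cong-≗ (λ v → cong (λ y → if does (P? (g x -ₘ y)) then u y else 0) (π≗f v)) ⟩
    ∑[ v < m ] (if does (P? (g x -ₘ f v)) then u (f v) else 0)
      ≡⟨ sum-cong-≗ (λ v → cong (λ t → if t then u (f v) else 0) (does-⇔ (⇔-sym (step v x)) (P? _) (P? _))) ⟩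
    ∑[ v < m ] (if does (P? (x -ₘ v)) then u (f v) else 0)
      ≡⟨ app-adjacency P? (u ∘ f) x ⟨
    app (adjacency P?) (u ∘ f) x
      ∎
    where open ≡-Reasoning

  Walk⇒Intertwines : ∀ {P} (P? : Decidable P) n {f g} → Walk (PermStep P) n f g →
                     Intertwines (adjacency P? ^ n) f g
  Walk⇒Intertwines P? zero    f≗g             u x = cong u (sym (f≗g x))
  Walk⇒Intertwines P? (suc n) (h , f→h , h→ⁿg) =
    Intertwines-resp-≈ᵒ {X = A ^ n ⊛ A} {Y = A ^ suc n} Aⁿ⊛A≈A¹⁺ⁿ
      (Intertwines-⊛ {X = A} {Y = A ^ n} (PermStep⇒Intertwines P? f→h) (Walk⇒Intertwines P? n h→ⁿg))
    where
    A = adjacency P?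
    Aⁿ⊛A≈A¹⁺ⁿ : A ^ n ⊛ A ≈ᵒ A ^ suc n
    Aⁿ⊛A≈A¹⁺ⁿ u x = trans (sym (^-homo-* A n 1 u x)) (^-congʳ A (+-comm n 1) u x)

  Walk⇒IsPermutation : ∀ {P n} .{{_ : NonZero n}} {f g} → Walk (PermStep P) n f g → IsPermutation f
  Walk⇒IsPermutation {n = suc n} (_ , (f-perm , _) , _) = f-perm

  δ : Fin m → Fin m → ℕ
  δ c y = indicator (y ≟ c)

  app-shifts-δ : ∀ {l P} → Coprime l m → (P? : Decidable P) → ∀ c x →
                 app (shifts (λ i → does (P? i)) (ψ m l)) (δ c) x ≡ indicator (·-dec l P? (x -ₘ c))
  app-shifts-δ {l} {P} l⊥m P? c x = begin
    app (shifts (λ i → does (P? i)) (ψ m l)) (δ c) x             ≡⟨ app-shifts _ (ψ m l) (δ c) x ⟩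
    ∑[ i < m ] (if does (P? i) then δ c (x -ₘ ψ m l i) else 0)   ≡⟨ sum-cong-≗ term≡indicator ⟩
    ∑[ i < m ] indicator (Q? i)                                   ≡⟨ ∑-indicator-unique Q? Q-unique ⟩
    indicator (any? Q?)                                           ≡⟨ indicator-⇔ ∃Q⇔l·P (any? Q?) (·-dec l P? _) ⟩
    indicator (·-dec l P? (x -ₘ c))                               ∎
    where
    open ≡-Reasoning
    Q : Fin m → Set
    Q i = P i × x -ₘ ψ m l i ≡ c
    Q? : Decidable Q
    Q? i = P? i ×-dec (x -ₘ ψ m l i ≟ c)
    term≡indicator : ∀ i → (if does (P? i) then δ c (x -ₘ ψ m l i) else 0) ≡ indicator (Q? i)
    term≡indicator i with does (P? i)
    ... | true  = refl
    ... | false = refl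
    Q-unique : ∀ {i j} → Q i → Q j → i ≡ j
    Q-unique (_ , x-ψi≡c) (_ , x-ψj≡c) =
      ψ-injective l⊥m (trans (sym (x-ₘy≡z⇒x-ₘz≡y x-ψi≡c)) (x-ₘy≡z⇒x-ₘz≡y x-ψj≡c))
    ∃Q⇔l·P : ∃ Q ⇔ (l · P) (x -ₘ c)
    ∃Q⇔l·P = mk⇔ (λ (i , Pi , x-ψi≡c) → i , Pi , sym (x-ₘy≡z⇒x-ₘz≡y x-ψi≡c))
                 (λ (i , Pi , ψi≡x-c) → i , Pi , x-ₘy≡z⇒x-ₘz≡y (sym ψi≡x-c))

  prime-Walk⇒PermStep : ∀ {p P f g} → Prime p → Coprime p m → Decidable P →
                        Walk (PermStep P) p f g → PermStep (p · P) f g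
  prime-Walk⇒PermStep {p} {P} {f} {g} p-prime p⊥m P? walk = f-perm , mkStep step
    where
    instance
      p≢0 : NonZero p
      p≢0 = prime⇒nonZero p-prime
    f-perm : IsPermutation f
    f-perm = Walk⇒IsPermutation {P = P} {n = p} walk
    A = adjacency P?
    B = shifts (λ i → does (P? i)) (ψ m p)
    δfv∘f≗δv : ∀ v → δ (f v) ∘ f ≗ δ v
    δfv∘f≗δv v y = indicator-⇔ (mk⇔ (IsPermutation⇒injective f-perm) (cong f)) (f y ≟ f v) (y ≟ v)
    step : ∀ v w → (p · P) (w -ₘ v) ⇔ (p · P) (g w -ₘ f v)
    step v w = indicator-injective-mod (nonTrivial⇒n>1 p {{prime⇒nonTrivial p-prime}})
                 (·-dec p P? (w -ₘ v)) (·-dec p P? (g w -ₘ f v)) (begin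
      indicator (·-dec p P? (w -ₘ v)) % p       ≡⟨ cong (_% p) (app-shifts-δ p⊥m P? v w) ⟨
      app B (δ v) w % p                         ≡⟨ frobenius p-prime _ id (δ v) w ⟨
      app (A ^ p) (δ v) w % p                   ≡⟨ cong (_% p) (app-cong (A ^ p) (δfv∘f≗δv v) w) ⟨
      app (A ^ p) (δ (f v) ∘ f) w % p           ≡⟨ cong (_% p) (Walk⇒Intertwines P? p walk (δ (f v)) w) ⟨
      app (A ^ p) (δ (f v)) (g w) % p           ≡⟨ frobenius p-prime _ id (δ (f v)) (g w) ⟩
      app B (δ (f v)) (g w) % p                 ≡⟨ cong (_% p) (app-shifts-δ p⊥m P? (f v) (g w)) ⟩
      indicator (·-dec p P? (g w -ₘ f v)) % p   ∎)
      where open ≡-Reasoning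

  coprime-*ˡ : ∀ {a b} → Coprime (a * b) m → Coprime a m
  coprime-*ˡ {b = b} ab⊥m (i∣a , i∣m) = ab⊥m (∣m⇒∣m*n b i∣a , i∣m)

  coprime-*ʳ : ∀ {a b} → Coprime (a * b) m → Coprime b m
  coprime-*ʳ {a = a} ab⊥m (i∣b , i∣m) = ab⊥m (∣n⇒∣m*n a i∣b , i∣m)

  product-Walk⇒PermStep : ∀ {P f g} ps → All Prime ps → Coprime (product ps) m → Decidable P →
                          Walk (PermStep P) (product ps) f g → PermStep (product ps · P) f g
  product-Walk⇒PermStep [] [] _ _ (_ , (f-perm , step) , h≗g) =
    f-perm , Step-resp-⇔ (λ d → ⇔-sym (1·P⇔P d)) (Step-cong (λ _ → refl) h≗g step)
  product-Walk⇒PermStep (p ∷ ps) (p-prime ∷ ps-prime) pq⊥m P? walk =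
    map₂ (Step-resp-⇔ (·-assoc p q))
      (prime-Walk⇒PermStep p-prime (coprime-*ˡ pq⊥m) (·-dec q P?)
        (Walk-map (product-Walk⇒PermStep ps ps-prime (coprime-*ʳ {a = p} pq⊥m) P?) p (Walk-blocks p walk)))
    where q = product ps

  Walk⇒PermStep : ∀ {l} {P : Fin m → Set} {f g} .{{_ : NonZero l}} → Coprime l m → Decidable P →
                  Walk (PermStep P) l f g → PermStep (l · P) f g
  Walk⇒PermStep {l} l⊥m P? walk with factorise l
  ... | record { factors = ps ; isFactorisation = refl ; factorsPrime = ps-prime } =
    product-Walk⇒PermStep ps ps-prime l⊥m P? walk

  module _ {k} {S : Fin k → Subset m} where

    GammaRel⇒Steps : ∀ {φ χ} → GammaRel S φ χ → IsPermutation φ × (∀ j → Step (_∈ S j) φ χ)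
    GammaRel⇒Steps (σ , σ-aut , σ₀≗φ , σ₁≗χ) =
      (σ (ℤ.+ 0) , σ₀≗φ) , λ j → Step-cong σ₀≗φ σ₁≗χ (mkStep λ v w → σ-aut (ℤ.+ 0) v w j)

    GammaPow⇒Walk : ∀ n {φ φ'} → GammaPow S n φ φ' → ∀ j → Walk (PermStep (_∈ S j)) n φ φ'
    GammaPow⇒Walk zero    φ≗φ'              j = φ≗φ'
    GammaPow⇒Walk (suc n) (χ , φ↦χ , χ↦ⁿφ') j =
      χ , map₂ (_$ j) (GammaRel⇒Steps φ↦χ) , GammaPow⇒Walk n χ↦ⁿφ' j

m≡1⇒Fin-trivial : ∀ {m} → m ≡ 1 → (x y : Fin m) → x ≡ y
m≡1⇒Fin-trivial refl zero zero = refl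

theorem3p14 : (m : ℕ) .{{_ : NonZero m}} (k : ℕ) (S : Fin k → Subset m) →
    Reduced S → (l : ℕ) → Coprime l m →
    (φ φ₀ φ₁ φₗ : Fin m → Fin m) →
    InAutCh S φ →
    (ψ m l ∘ φ₀) ≗ (φ ∘ ψ m l) →
    GammaRel S φ₀ φ₁ →
    GammaPow S l φ φₗ →
    (ψ m l ∘ φ₁) ≗ (φₗ ∘ ψ m l)
theorem3p14 m _ S _ zero 0⊥m _ _ _ _ _ _ _ _ _ = m≡1⇒Fin-trivial (0-coprimeTo-m⇒m≡1 0⊥m) _ _
theorem3p14 m _ S reduced l@(suc _) l⊥m φ φ₀ φ₁ φₗ _ ψφ₀≗φψ φ₀↦φ₁ φ↦ˡφₗ x = begin
  ψ m l (φ₁ x)                     ≡⟨ cong (ψ m l) (Step-unique reduced φ₀-onto φ₀↦φ₁-step φ₀↦φₗ-conjugate x) ⟩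
  ψ m l (ψ m l⁻¹ (φₗ (ψ m l x)))   ≡⟨ ψ-inverseʳ {k = l⁻¹} l⁻¹l≡1 (φₗ (ψ m l x)) ⟩
  φₗ (ψ m l x)                     ∎
  where
  open ≡-Reasoning
  l⁻¹ = proj₁ (coprime⇒inverse-mod m l⊥m)
  l⁻¹l≡1 = proj₂ (coprime⇒inverse-mod m l⊥m)
  φ₀-onto = IsPermutation⇒surjective (proj₁ (GammaRel⇒Steps φ₀↦φ₁))
  φ₀↦φ₁-step = proj₂ (GammaRel⇒Steps φ₀↦φ₁)
  φ↦φₗ-step : ∀ j → Step (l · (_∈ S j)) φ φₗ
  φ↦φₗ-step j = proj₂ (Walk⇒PermStep l⊥m (_∈? S j) (GammaPow⇒Walk l φ↦ˡφₗ j))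
  φ₀↦φₗ-conjugate : ∀ j → Step (_∈ S j) φ₀ (ψ m l⁻¹ ∘ φₗ ∘ ψ m l)
  φ₀↦φₗ-conjugate j =
    Step-conjugate l⊥m (φ↦φₗ-step j) ψφ₀≗φψ (λ y → ψ-inverseʳ {k = l⁻¹} l⁻¹l≡1 (φₗ (ψ m l y)))
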